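{- Let $k$ be a Riesel number constructed using the covering system method, i.e. $k$ is an odd positive integer for which there exist a covering system $\{r_j\pmod{m_j}:1\le j\le\tau\}$ and distinct primes $p_1,\dots,p_\tau$ with $p_j\mid 2^{m_j}-1$, such that $k\equiv 2^{ -r_j}\pmod{p_j}$ and $k\cdot 2^n-1>p_j$ for all $1\le j\le\tau$ and all positive integers $n$. Then for every integer $b\ge2$ there exist infinitely many positive integers $t$ such that the $b$-repinteger $k_b^{(t)}$ is a Riesel number.
   Context: A covering system of the integers is a finite collection of congruences $r_j \pmod{m_j}$ such that every integer satisfies at least one of them. $2^{ -r}\pmod p$ denotes the inverse of $2^r$ modulo the odd prime $p$. A Riesel number is an odd positive integer $k$ such that $k\cdot 2^n-1$ is composite for all positive integers $n$. For integers $b\ge2$, $k\ge1$, $t\ge1$, the $b$-repinteger is $k_b^{(t)}=k\,(b^{\ell t}-1)/(b^\ell-1)$ where $\ell=\lfloor\log_b k\rfloor+1$ is the number of base-$b$ digits of $k$. -}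

module Defs where

open import Data.Nat using (ℕ; zero; suc; _+_; _*_; _∸_; _^_; _<_; _≤_; _<ᵇ_)
open import Data.Nat.DivMod using (_/_)
open import Data.Nat.Divisibility using (_∣_)
open import Data.Nat.Primality using (Composite; Prime)
open import Relation.Binary.PropositionalEquality using (_≡_; refl)
open import Data.Bool using (if_then_else_)
open import Data.Fin using (Fin)
open import Data.Integer as ℤ using (ℤ; +_)
import Data.Integer.Divisibility as ℤD
open import Data.Product using (Σ; ∃; _×_)
open import Relation.Nullary using (¬_)

Odd : ℕ → Set
Odd k = ¬ (2 ∣ k)

Riesel : ℕ → Set
Riesel k = Odd k × (1 ≤ k) × (∀ n → 1 ≤ n → Composite (k * 2 ^ n ∸ 1))

-- number of base-b digits of k (for b ≥ 2, k ≥ 1), i.e. ⌊log_b k⌋ + 1.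
-- Computed by repeated division; the fuel argument (= k) is always enough for b ≥ 2.
digitsAux : ℕ → ℕ → ℕ → ℕ
digitsAux zero    b k = 1
digitsAux (suc f) (suc (suc b')) k =
  if k <ᵇ suc (suc b') then 1 else suc (digitsAux f (suc (suc b')) (k / suc (suc b')))
digitsAux (suc f) _ k = 1

numDigits : ℕ → ℕ → ℕ
numDigits b k = digitsAux k b k

sumBelow : ℕ → (ℕ → ℕ) → ℕ
sumBelow zero    f = 0
sumBelow (suc t) f = sumBelow t f + f t

-- the b-repinteger k_b^(t) = k (b^{ℓt} − 1)/(b^ℓ − 1) = Σ_{i<t} k b^{ℓ i}, ℓ = numDigits b k
repint : ℕ → ℕ → ℕ → ℕ
repint b k t = sumBelow t (λ i → k * b ^ (numDigits b k * i))

Covering : (τ : ℕ) → (Fin τ → ℕ) → (Fin τ → ℕ) → Set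
Covering τ r m = (∀ j → 1 ≤ m j) ×
  (∀ (x : ℤ) → ∃ λ j → (+ m j) ℤD.∣ (x ℤ.- + r j))

CoveringRiesel : ℕ → Set
CoveringRiesel k =
  Odd k × (1 ≤ k) ×
  Σ ℕ λ τ → Σ (Fin τ → ℕ) λ r → Σ (Fin τ → ℕ) λ m → Σ (Fin τ → ℕ) λ p →
    Covering τ r m ×
    (∀ i j → p i ≡ p j → i ≡ j) ×
    (∀ j → Prime (p j)) ×
    (∀ j → p j ∣ 2 ^ m j ∸ 1) ×
    (∀ j → p j ∣ k * 2 ^ r j ∸ 1) ×
    (∀ j n → 1 ≤ n → p j < k * 2 ^ n ∸ 1)

{-# OPTIONS --safe #-}
module Submission where

-- The repinteger is k·R with R = 1 + B + ⋯ + B^(t−1), B = b^ℓ. For a prime q, either q ∣ B or two of the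
-- partial sums R_0, …, R_q agree mod q; either way q ∣ B·R_d for some 1 ≤ d ≤ q, and then q ∣ B·R_e for
-- every multiple e of d. With K = 2k and t = 1 + N·K!, R = 1 + B·R_{N·K!} is thus ≡ 1 modulo 2 and modulo
-- every p_j < 2k. So k·R is odd, and for the p_j whose congruence covers n,
-- k·R·2^n − 1 ≡ k·2^n − 1 ≡ 0 (mod p_j) while p_j < k·2^n − 1 ≤ k·R·2^n − 1.

open import Defs
open import Data.Nat using (ℕ; _≤_; _<_)
open import Data.Product using (∃; _×_)

open import Data.Nat.Base using (zero; suc; _+_; _*_; _∸_; _^_; _!; z≤n; s≤s; s≤s⁻¹; NonZero; >-nonZero; >-nonZero⁻¹)
open import Data.Nat.Properties
open import Data.Nat.DivMod using (_%_; _/_; _mod_; m≡m%n+[m/n]*n)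
open import Data.Nat.Divisibility
open import Data.Nat.Primality using (Prime; Composite; prime[2]; prime⇒nonZero; prime⇒nonTrivial; euclidsLemma)
open import Data.Fin.Base using (toℕ)
open import Data.Fin.Properties using (toℕ<n; fromℕ<-injective; pigeonhole)
import Data.Integer.Base as ℤ
open import Data.Integer.Properties using ([+m]-[+n]≡m⊖n; ∣⊖∣-≤; ∣m⊖n∣≡∣n⊖m∣)
open import Data.Product using (_,_; ∃₂)
open import Data.Sum using (inj₁; inj₂)
open import Data.Empty using (⊥-elim)
open import Function.Bundles using (_⇔_; mk⇔; Equivalence)
open import Relation.Nullary using (yes; no; ¬_)
open import Relation.Binary.PropositionalEquality
open import Algebra.Properties.CommutativeSemigroup *-commutativeSemigroup using (xy∙z≈xz∙y)
open import Data.Nat.Solver using (module +-*-Solver)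
open +-*-Solver using (solve; _:+_; _:*_; _:=_; con)

m%n≡[m+o]%n⇒n∣o : ∀ m o {n} .{{_ : NonZero n}} → m % n ≡ (m + o) % n → n ∣ o
m%n≡[m+o]%n⇒n∣o m o {n} eq = divides ((m + o) / n ∸ m / n) (begin
  o                                               ≡⟨ m+n∸m≡n m o ⟨
  (m + o) ∸ m                                     ≡⟨ cong₂ _∸_ (m≡m%n+[m/n]*n (m + o) n) (m≡m%n+[m/n]*n m n) ⟩
  ((m + o) % n + (m + o) / n * n) ∸ (m % n + m / n * n)
                                                  ≡⟨ cong (λ r → (r + (m + o) / n * n) ∸ (m % n + m / n * n)) eq ⟨
  (m % n + (m + o) / n * n) ∸ (m % n + m / n * n) ≡⟨ [m+n]∸[m+o]≡n∸o (m % n) _ _ ⟩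
  (m + o) / n * n ∸ m / n * n                     ≡⟨ *-distribʳ-∸ n ((m + o) / n) (m / n) ⟨
  ((m + o) / n ∸ m / n) * n                       ∎)
  where open ≡-Reasoning

prime∤m⇒∣m^n*o⇒∣o : ∀ {p m o} → Prime p → ¬ p ∣ m → ∀ n → p ∣ m ^ n * o → p ∣ o
prime∤m⇒∣m^n*o⇒∣o {p} {o = o} pp p∤m zero    p∣ = subst (p ∣_) (*-identityˡ o) p∣
prime∤m⇒∣m^n*o⇒∣o {p} {m} {o} pp p∤m (suc n) p∣
  with euclidsLemma m (m ^ n * o) pp (subst (p ∣_) (*-assoc m (m ^ n) o) p∣)
... | inj₁ p∣m  = ⊥-elim (p∤m p∣m)
... | inj₂ p∣m^n*o = prime∤m⇒∣m^n*o⇒∣o pp p∤m n p∣m^n*o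

0<m≤n⇒m∣n! : ∀ {m n} → 0 < m → m ≤ n → m ∣ n !
0<m≤n⇒m∣n! {suc m} _ 1+m≤n = ∣-trans (m∣m*n (m !)) (m≤n⇒m!∣n! 1+m≤n)

∣n⇒∤suc[n] : ∀ {d n} → 1 < d → d ∣ n → ¬ d ∣ suc n
∣n⇒∤suc[n] {d} {n} 1<d d∣n d∣suc[n] =
  >⇒≢ 1<d (∣1⇒≡1 (∣m+n∣m⇒∣n (subst (d ∣_) (+-comm 1 n) d∣suc[n]) d∣n))

Odd-* : ∀ {m n} → Odd m → Odd n → Odd (m * n)
Odd-* {m} {n} odd-m odd-n 2∣mn with euclidsLemma m n prime[2] 2∣mn
... | inj₁ 2∣m = odd-m 2∣m
... | inj₂ 2∣n = odd-n 2∣n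

repunit : ℕ → ℕ → ℕ
repunit B zero    = 0
repunit B (suc t) = 1 + B * repunit B t

repunit-sucʳ : ∀ B t → repunit B (suc t) ≡ repunit B t + B ^ t
repunit-sucʳ B zero    = cong suc (*-zeroʳ B)
repunit-sucʳ B (suc t) =
  cong suc (trans (cong (B *_) (repunit-sucʳ B t)) (*-distribˡ-+ B (repunit B t) (B ^ t)))

repunit-+ : ∀ B m n → repunit B (m + n) ≡ repunit B m + B ^ m * repunit B n
repunit-+ B zero    n = sym (+-identityʳ (repunit B n))
repunit-+ B (suc m) n = cong suc (begin
  B * repunit B (m + n)                           ≡⟨ cong (B *_) (repunit-+ B m n) ⟩
  B * (repunit B m + B ^ m * repunit B n)         ≡⟨ *-distribˡ-+ B _ _ ⟩
  B * repunit B m + B * (B ^ m * repunit B n)     ≡⟨ cong (B * repunit B m +_) (*-assoc B (B ^ m) _) ⟨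
  B * repunit B m + B * B ^ m * repunit B n       ∎)
  where open ≡-Reasoning

repint≡k*repunit : ∀ b k t → repint b k t ≡ k * repunit (b ^ numDigits b k) t
repint≡k*repunit b k zero    = sym (*-zeroʳ k)
repint≡k*repunit b k (suc t) = begin
  repint b k t + k * b ^ (ℓ * t)  ≡⟨ cong₂ _+_ (repint≡k*repunit b k t) (cong (k *_) (sym (^-*-assoc b ℓ t))) ⟩
  k * repunit B t + k * B ^ t     ≡⟨ *-distribˡ-+ k (repunit B t) (B ^ t) ⟨
  k * (repunit B t + B ^ t)       ≡⟨ cong (k *_) (repunit-sucʳ B t) ⟨
  k * repunit B (suc t)           ∎
  where
  open ≡-Reasoning
  ℓ B : ℕ
  ℓ = numDigits b k
  B = b ^ ℓ

∣B*repunit[d]⇒∣B*repunit[q*d] : ∀ {p} B d → p ∣ B * repunit B d → ∀ q → p ∣ B * repunit B (q * d)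
∣B*repunit[d]⇒∣B*repunit[q*d] B d p∣ zero    = ∣n⇒∣m*n B (_ ∣0)
∣B*repunit[d]⇒∣B*repunit[q*d] {p} B d p∣ (suc q) = subst (p ∣_) (sym split)
  (∣m∣n⇒∣m+n p∣ (∣n⇒∣m*n (B ^ d) (∣B*repunit[d]⇒∣B*repunit[q*d] B d p∣ q)))
  where
  split : B * repunit B (d + q * d) ≡ B * repunit B d + B ^ d * (B * repunit B (q * d))
  split = trans (cong (B *_) (repunit-+ B d (q * d)))
    (solve 4 (λ b x y z → b :* (x :+ y :* z) := b :* x :+ y :* (b :* z))
      refl B (repunit B d) (B ^ d) (repunit B (q * d)))

∣B*repunit[d]⇒∣B*repunit[e] : ∀ {p} B {d e} → p ∣ B * repunit B d → d ∣ e → p ∣ B * repunit B e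
∣B*repunit[d]⇒∣B*repunit[e] B {d} p∣ (divides-refl q) = ∣B*repunit[d]⇒∣B*repunit[q*d] B d p∣ q

repunit-residue-collision : ∀ B p .{{_ : NonZero p}} →
  ∃₂ λ a c → a < c × c ≤ p × repunit B a % p ≡ repunit B c % p
repunit-residue-collision B p
  with i , j , i<j , same-residue ← pigeonhole (n<1+n p) (λ i → repunit B (toℕ i) mod p)
  = toℕ i , toℕ j , i<j , s≤s⁻¹ (toℕ<n j) , fromℕ<-injective _ _ _ _ same-residue

prime∤B⇒∃[d≤p]p∣repunit : ∀ {p} B → Prime p → ¬ p ∣ B → ∃ λ d → 0 < d × d ≤ p × p ∣ repunit B d
prime∤B⇒∃[d≤p]p∣repunit {p} B pp p∤B
  with a , c , a<c , c≤p , same-residue ← repunit-residue-collision B p {{prime⇒nonZero pp}}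
  = c ∸ a , m<n⇒0<n∸m a<c , ≤-trans (m∸n≤m c a) c≤p ,
    prime∤m⇒∣m^n*o⇒∣o pp p∤B a (m%n≡[m+o]%n⇒n∣o (repunit B a) _ residues)
  where
  instance _ = prime⇒nonZero pp
  residues : repunit B a % p ≡ (repunit B a + B ^ a * repunit B (c ∸ a)) % p
  residues = trans same-residue
    (cong (_% p) (trans (cong (repunit B) (sym (m+[n∸m]≡n (<⇒≤ a<c)))) (repunit-+ B a (c ∸ a))))

∃[d≤p]p∣B*repunit : ∀ {p} B → Prime p → ∃ λ d → 0 < d × d ≤ p × p ∣ B * repunit B d
∃[d≤p]p∣B*repunit {p} B pp with p ∣? B
... | yes p∣B = 1 , s≤s z≤n , >-nonZero⁻¹ p {{prime⇒nonZero pp}} , ∣m⇒∣m*n _ p∣B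
... | no  p∤B with d , 0<d , d≤p , p∣ ← prime∤B⇒∃[d≤p]p∣repunit B pp p∤B
  = d , 0<d , d≤p , ∣n⇒∣m*n B p∣

prime≤K⇒p∣B*repunit[n*K!] : ∀ {p} B K n → Prime p → p ≤ K → p ∣ B * repunit B (n * K !)
prime≤K⇒p∣B*repunit[n*K!] B K n pp p≤K with d , 0<d , d≤p , p∣ ← ∃[d≤p]p∣B*repunit B pp
  = ∣B*repunit[d]⇒∣B*repunit[e] B p∣ (∣n⇒∣m*n n (0<m≤n⇒m∣n! 0<d (≤-trans d≤p p≤K)))

-- d ∣ x ∸ 1 encodes x ≡ 1 (mod d); by truncation it holds vacuously at x = 0, hence the 1 ≤ _ side conditions.
m*n∸1≡m*[n∸1]+[m∸1] : ∀ m n → 1 ≤ n → m * n ∸ 1 ≡ m * (n ∸ 1) + (m ∸ 1)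
m*n∸1≡m*[n∸1]+[m∸1] zero    n       _ = refl
m*n∸1≡m*[n∸1]+[m∸1] (suc m) (suc n) _ =
  solve 2 (λ m n → n :+ m :* (con 1 :+ n) := (con 1 :+ m) :* n :+ m) refl m n

∣∸1-*-closed : ∀ {d} a {y} → 1 ≤ y → d ∣ a ∸ 1 → d ∣ y ∸ 1 → d ∣ a * y ∸ 1
∣∸1-*-closed {d} a {y} 1≤y d∣a∸1 d∣y∸1 =
  subst (d ∣_) (sym (m*n∸1≡m*[n∸1]+[m∸1] a y 1≤y)) (∣m∣n⇒∣m+n (∣n⇒∣m*n a d∣y∸1) d∣a∸1)

∣∸1-*-cancelʳ : ∀ {d} a {y} → 1 ≤ y → d ∣ y ∸ 1 → d ∣ a * y ∸ 1 → d ∣ a ∸ 1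
∣∸1-*-cancelʳ {d} a {y} 1≤y d∣y∸1 d∣ay∸1 =
  ∣m+n∣m⇒∣n (subst (d ∣_) (m*n∸1≡m*[n∸1]+[m∸1] a y 1≤y) d∣ay∸1) (∣n⇒∣m*n a d∣y∸1)

∣∸1-^-closed : ∀ {d x} → 1 ≤ x → d ∣ x ∸ 1 → ∀ q → d ∣ x ^ q ∸ 1
∣∸1-^-closed         1≤x d∣x∸1 zero    = _ ∣0
∣∸1-^-closed {x = x} 1≤x d∣x∸1 (suc q) =
  ∣∸1-*-closed x (m^n>0 x {{>-nonZero 1≤x}} q) d∣x∸1 (∣∸1-^-closed 1≤x d∣x∸1 q)

∣∸1-shift : ∀ {d x m} a i {j} → 1 ≤ x → d ∣ x ^ m ∸ 1 → m ∣ j →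
  d ∣ a * x ^ (i + j) ∸ 1 ⇔ d ∣ a * x ^ i ∸ 1
∣∸1-shift {d} {x} {m} a i 1≤x d∣x^m∸1 (divides-refl q) = mk⇔
  (λ d∣ → ∣∸1-*-cancelʳ (a * x ^ i) 1≤y d∣y∸1 (subst (λ n → d ∣ n ∸ 1) split d∣))
  (λ d∣ → subst (λ n → d ∣ n ∸ 1) (sym split) (∣∸1-*-closed (a * x ^ i) 1≤y d∣ d∣y∸1))
  where
  y : ℕ
  y = (x ^ m) ^ q
  1≤x^m : 1 ≤ x ^ m
  1≤x^m = m^n>0 x {{>-nonZero 1≤x}} m
  1≤y : 1 ≤ y
  1≤y = m^n>0 (x ^ m) {{>-nonZero 1≤x^m}} q
  d∣y∸1 : d ∣ y ∸ 1
  d∣y∸1 = ∣∸1-^-closed 1≤x^m d∣x^m∸1 q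
  split : a * x ^ (i + q * m) ≡ a * x ^ i * y
  split = begin
    a * x ^ (i + q * m)     ≡⟨ cong (λ e → a * x ^ (i + e)) (*-comm q m) ⟩
    a * x ^ (i + m * q)     ≡⟨ cong (a *_) (^-distribˡ-+-* x i (m * q)) ⟩
    a * (x ^ i * x ^ (m * q)) ≡⟨ *-assoc a (x ^ i) _ ⟨
    a * x ^ i * x ^ (m * q) ≡⟨ cong (a * x ^ i *_) (^-*-assoc x m q) ⟨
    a * x ^ i * y           ∎
    where open ≡-Reasoning

∣m⊖[m+j]∣≡j : ∀ m j → ℤ.∣ m ℤ.⊖ (m + j) ∣ ≡ j
∣m⊖[m+j]∣≡j m j = trans (∣⊖∣-≤ (m≤m+n m j)) (m+n∸m≡n m j)

∣[m+j]⊖m∣≡j : ∀ m j → ℤ.∣ (m + j) ℤ.⊖ m ∣ ≡ j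
∣[m+j]⊖m∣≡j m j = trans (∣m⊖n∣≡∣n⊖m∣ (m + j) m) (∣m⊖[m+j]∣≡j m j)

∣∸1-covered : ∀ {d x m} a r n → 1 ≤ x → d ∣ x ^ m ∸ 1 → m ∣ ℤ.∣ n ℤ.⊖ r ∣ →
  d ∣ a * x ^ r ∸ 1 → d ∣ a * x ^ n ∸ 1
∣∸1-covered {m = m} a r n 1≤x d∣x^m∸1 m∣∣n⊖r∣ d∣ with ≤-total r n
... | inj₁ r≤n with j , refl ← m≤n⇒∃[o]m+o≡n r≤n =
  Equivalence.from (∣∸1-shift a r 1≤x d∣x^m∸1 (subst (m ∣_) (∣[m+j]⊖m∣≡j r j) m∣∣n⊖r∣)) d∣
... | inj₂ n≤r with j , refl ← m≤n⇒∃[o]m+o≡n n≤r =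
  Equivalence.to (∣∸1-shift a n 1≤x d∣x^m∸1 (subst (m ∣_) (∣m⊖[m+j]∣≡j n j) m∣∣n⊖r∣)) d∣

prime∣∸1⇒composite : ∀ {p} a {y} → Prime p → p < a ∸ 1 → p ∣ a ∸ 1 → 1 ≤ y → p ∣ y ∸ 1 →
  Composite (a * y ∸ 1)
prime∣∸1⇒composite a {y} pp p<a∸1 p∣a∸1 1≤y p∣y∸1 = hasNonTrivialDivisor {{prime⇒nonTrivial pp}}
  (<-≤-trans p<a∸1 (∸-monoˡ-≤ 1 (m≤m*n a y {{>-nonZero 1≤y}})))
  (∣∸1-*-closed a 1≤y p∣a∸1 p∣y∸1)

coveringRiesel⇒Riesel[k*[1+x]] : ∀ {k} x → CoveringRiesel k →
  (∀ {q} → Prime q → q ≤ k * 2 ^ 1 → q ∣ x) → Riesel (k * suc x)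
coveringRiesel⇒Riesel[k*[1+x]] {k} x
  (odd-k , 1≤k , _ , r , m , p , (_ , covers) , _ , prime-p , p∣2^m∸1 , p∣k2^r∸1 , p<k2^n∸1) small∣x =
  Odd-* odd-k (∣n⇒∤suc[n] (s≤s (s≤s z≤n)) (small∣x prime[2] (*-monoˡ-≤ 2 1≤k))) ,
  *-mono-≤ 1≤k (s≤s z≤n) ,
  composite-n
  where
  composite-n : ∀ n → 1 ≤ n → Composite (k * suc x * 2 ^ n ∸ 1)
  composite-n n 1≤n with j , m∣n-r ← covers (ℤ.+ n) =
    subst (λ z → Composite (z ∸ 1)) (sym (xy∙z≈xz∙y k (suc x) (2 ^ n)))
      (prime∣∸1⇒composite (k * 2 ^ n) (prime-p j) (p<k2^n∸1 j n 1≤n) p∣k2^n∸1 (s≤s z≤n) p∣x)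
    where
    p∣k2^n∸1 : p j ∣ k * 2 ^ n ∸ 1
    p∣k2^n∸1 = ∣∸1-covered k (r j) n (s≤s z≤n) (p∣2^m∸1 j)
      (subst (λ z → m j ∣ ℤ.∣ z ∣) ([+m]-[+n]≡m⊖n n (r j)) m∣n-r) (p∣k2^r∸1 j)
    p∣x : p j ∣ x
    p∣x = small∣x (prime-p j) (≤-trans (<⇒≤ (p<k2^n∸1 j 1 (s≤s z≤n))) (m∸n≤m (k * 2 ^ 1) 1))

theorem3p4 : (k : ℕ) → CoveringRiesel k →
    (b : ℕ) → 2 ≤ b → (N : ℕ) → ∃ λ t → N < t × Riesel (repint b k t)
theorem3p4 k covering b _ N =
  t , s≤s (m≤m*n N (K !) {{K !≢0}}) ,
  subst Riesel (sym (repint≡k*repunit b k t))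
    (coveringRiesel⇒Riesel[k*[1+x]] (B * repunit B (N * K !)) covering (prime≤K⇒p∣B*repunit[n*K!] B K N))
  where
  K t B : ℕ
  K = k * 2 ^ 1
  t = suc (N * K !)
  B = b ^ numDigits b k
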